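{- Let $A$ be an integer configuration matrix with $n$ columns, let $N\ge 1$, and let $\mathbf z=(\mathbf z_1,\dots,\mathbf z_N)$ be a move for the $N$-th Lawrence lifting $A^{(N)}$ such that each slice $\mathbf z_k$ is a non-zero indispensable move for $A$. Then $\mathbf z$ is an indispensable move for $A^{(N)}$ if and only if $\sum_{k\in M}\mathbf z_k\neq 0$ for every non-empty proper subset $M$ of $[N]=\{1,\dots,N\}$.
   Context: For a configuration $B$ with $m$ columns, a move is an element of $\ker_{\mathbb Z}B$; write $\mathbf z=\mathbf z^+-\mathbf z^-$ with $\mathbf z^\pm\in\mathbb N^m$ of disjoint support. A move $\mathbf z$ is indispensable if the fiber $\{\mathbf x\in\mathbb N^m\mid B\mathbf x=B\mathbf z^+\}$ equals the two-element set $\{\mathbf z^+,\mathbf z^-\}$ (equivalently, $\pm\mathbf z$ belongs to every Markov basis). The $N$-th Lawrence lifting $A^{(N)}$ is the configuration acting on $(\mathbf x_1,\dots,\mathbf x_N)\in\mathbb Z^{nN}$ by $(\mathbf x_1,\dots,\mathbf x_N)\mapsto(A\mathbf x_1,\dots,A\mathbf x_N,\mathbf x_1+\dots+\mathbf x_N)$; its moves are $\mathbf z=(\mathbf z_1,\dots,\mathbf z_N)$ with each slice $\mathbf z_k\in\ker_{\mathbb Z}A$ and $\sum_{k}\mathbf z_k=0$. -}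

module Defs where

open import Data.Nat using (ℕ; zero; suc)
open import Data.Integer using (ℤ; +_; -[1+_]; _+_; _*_; 0ℤ)
open import Data.Fin using (Fin; zero; suc)
open import Data.Fin.Subset using (Subset; _∈_; _∉_; Nonempty)
open import Data.Vec using (lookup)
open import Data.Bool using (Bool; true; false; if_then_else_)
open import Data.Product using (_×_; _,_; ∃; proj₁; proj₂)
open import Data.Sum using (_⊎_; inj₁; inj₂)
open import Relation.Nullary using (¬_)
open import Relation.Binary.PropositionalEquality using (_≡_)
open import Function.Bundles using (_⇔_)

∑ : ∀ {n} → (Fin n → ℤ) → ℤ
∑ {zero}  f = 0ℤ
∑ {suc n} f = f zero + ∑ (λ i → f (suc i))

pos : ℤ → ℕ
pos (+ n)    = n
pos -[1+ n ] = 0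

neg : ℤ → ℕ
neg (+ n)    = 0
neg -[1+ n ] = suc n

_≗_ : {C : Set} {X : Set} → (C → X) → (C → X) → Set
f ≗ g = ∀ c → f c ≡ g c

-- A configuration, presented abstractly as a ℤ-linear map from column-vectors
-- (indexed by C) to row-vectors (indexed by R).
Config : Set → Set → Set
Config C R = (C → ℤ) → (R → ℤ)

_⁺ : {C : Set} → (C → ℤ) → (C → ℕ)
(z ⁺) c = pos (z c)

_⁻ : {C : Set} → (C → ℤ) → (C → ℕ)
(z ⁻) c = neg (z c)

toℤ : {C : Set} → (C → ℕ) → (C → ℤ)
toℤ x c = + (x c)

IsMoveC : {C R : Set} → Config C R → (C → ℤ) → Set
IsMoveC B z = B z ≗ (λ _ → 0ℤ)

IsIndispensableC : {C R : Set} → Config C R → (C → ℤ) → Set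
IsIndispensableC {C} B z =
  IsMoveC B z ×
  ((x : C → ℕ) → (B (toℤ x) ≗ B (toℤ (z ⁺))) ⇔ (x ≗ (z ⁺) ⊎ x ≗ (z ⁻)))

Matrix : ℕ → ℕ → Set
Matrix d n = Fin d → Fin n → ℤ

act : ∀ {d n} → Matrix d n → Config (Fin n) (Fin d)
act A x i = ∑ (λ j → A i j * x j)

-- Columns indexed by Fin N × Fin n ((k , j) ↦ j-th entry of x_k);
-- rows by (Fin N × Fin d) ⊎ Fin n.
lawrence : ∀ {d n} (N : ℕ) → Matrix d n → Config (Fin N × Fin n) ((Fin N × Fin d) ⊎ Fin n)
lawrence N A x (inj₁ (k , i)) = act A (λ j → x (k , j)) i
lawrence N A x (inj₂ j)       = ∑ (λ k → x (k , j))

IsMove : ∀ {d n} → Matrix d n → (Fin n → ℤ) → Set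
IsMove A = IsMoveC (act A)

IsIndispensable : ∀ {d n} → Matrix d n → (Fin n → ℤ) → Set
IsIndispensable A = IsIndispensableC (act A)

flat : ∀ {N n} → (Fin N → Fin n → ℤ) → (Fin N × Fin n → ℤ)
flat z (k , j) = z k j

sumOver : ∀ {N n} → Subset N → (Fin N → Fin n → ℤ) → (Fin n → ℤ)
sumOver M z j = ∑ (λ k → if lookup M k then z k j else 0ℤ)

IsZeroVec : ∀ {n} → (Fin n → ℤ) → Set
IsZeroVec v = v ≗ (λ _ → 0ℤ)

NonemptyProper : ∀ {N} → Subset N → Set
NonemptyProper {N} M = Nonempty M × ∃ (λ (k : Fin N) → k ∉ M)

module Submission where

-- Let every slice z_k be a non-zero indispensable move of A, so the A-fibre of z_k⁺ is
-- exactly {z_k⁺, z_k⁻}.  For a subset M ⊆ [N] let the mix x_M be the vector that takes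
-- z_k⁻ on the slices k ∈ M and z_k⁺ on the others.  The first N block rows of A^(N) never
-- distinguish x_M from z⁺, while its last block row (the column sums) gives, coordinatewise,
--      Σ_k x_M,k + Σ_{k∈M} z_k = Σ_k z_k⁺ .
-- Hence the A^(N)-fibre of z⁺ consists precisely of the mixes x_M with Σ_{k∈M} z_k = 0
-- (lawrence-fibre).  As every z_k is non-zero, x_M = z⁺ forces M = ∅ and x_M = z⁻ forces
-- M = [N]; and z⁺ = x_∅, z⁻ = x_[N] lie in the fibre because Σ_k z_k = 0 (z is a move).
-- So the fibre is {z⁺, z⁻} iff no non-empty proper M has Σ_{k∈M} z_k = 0.

open import Defs
open import Data.Nat using (ℕ; _≤_)
open import Data.Integer using (ℤ; +_; -[1+_]; _+_; _*_; 0ℤ)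
import Data.Integer.Properties as ℤ
open import Data.Fin using (Fin)
open import Data.Fin.Subset using (Subset; _∈_; _∉_; ⊤)
open import Data.Fin.Subset.Properties using (_∈?_; ∈⊤)
open import Data.Fin.Properties using (any?)
open import Data.Bool using (Bool; true; false; if_then_else_)
open import Data.Vec using (lookup; tabulate)
open import Data.Vec.Properties using (lookup∘tabulate; []=⇒lookup; lookup⇒[]=)
open import Data.Product using (_×_; _,_; proj₁; proj₂; ∃; Σ)
open import Data.Sum using (_⊎_; inj₁; inj₂)
open import Data.Empty using (⊥-elim)
open import Relation.Nullary using (¬_; yes; no; ¬?)
open import Relation.Nullary.Decidable using (decidable-stable)
open import Function.Bundles using (_⇔_; mk⇔; Equivalence)
open import Relation.Binary.PropositionalEquality
  using (_≡_; refl; sym; trans; cong; cong₂; subst; module ≡-Reasoning)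
open import Algebra.Properties.CommutativeMonoid.Sum ℤ.+-0-commutativeMonoid
  using (sum; sum-cong-≗; ∑-distrib-+)
open import Algebra.Bundles using (AbelianGroup)
open import Algebra.Properties.Group (AbelianGroup.group ℤ.+-0-abelianGroup)
  using (identityʳ-unique)

∑≡sum : ∀ {N} (f : Fin N → ℤ) → ∑ f ≡ sum f
∑≡sum {ℕ.zero}  f = refl
∑≡sum {ℕ.suc N} f = cong (λ s → f Fin.zero + s) (∑≡sum (λ k → f (Fin.suc k)))

∑-cong : ∀ {N} {f g : Fin N → ℤ} → f ≗ g → ∑ f ≡ ∑ g
∑-cong {f = f} {g} f≗g = trans (∑≡sum f) (trans (sum-cong-≗ f≗g) (sym (∑≡sum g)))

∑-+ : ∀ {N} (f g : Fin N → ℤ) → ∑ (λ k → f k + g k) ≡ ∑ f + ∑ g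
∑-+ {N} f g = begin
  ∑ (λ k → f k + g k)        ≡⟨ ∑≡sum (λ k → f k + g k) ⟩
  sum {N} (λ k → f k + g k)  ≡⟨ ∑-distrib-+ f g ⟩
  sum f + sum g              ≡⟨ sym (cong₂ _+_ (∑≡sum f) (∑≡sum g)) ⟩
  ∑ f + ∑ g                  ∎
  where open ≡-Reasoning

offset-zero⇔ : ∀ {a s c : ℤ} → a + s ≡ c → (a ≡ c ⇔ s ≡ 0ℤ)
offset-zero⇔ {a} {s} a+s≡c = mk⇔
  (λ a≡c → identityʳ-unique a s (trans a+s≡c (sym a≡c)))
  (λ { refl → trans (sym (ℤ.+-identityʳ a)) a+s≡c })

neg+self≡pos : ∀ a → + neg a + a ≡ + pos a
neg+self≡pos (+ n)    = ℤ.+-identityˡ (+ n)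
neg+self≡pos -[1+ n ] = ℤ.n⊖n≡0 (ℕ.suc n)

pos≡neg⇒0 : ∀ a → pos a ≡ neg a → a ≡ 0ℤ
pos≡neg⇒0 (+ n)    n≡0 = cong +_ n≡0
pos≡neg⇒0 -[1+ n ] ()

part : Bool → ℤ → ℕ
part b a = if b then neg a else pos a

part+selected : ∀ b a → + part b a + (if b then a else 0ℤ) ≡ + pos a
part+selected false a = ℤ.+-identityʳ (+ pos a)
part+selected true  a = neg+self≡pos a

choose-part : ∀ {n} {u : Fin n → ℕ} {v : Fin n → ℤ}
  → u ≗ (λ j → part false (v j)) ⊎ u ≗ (λ j → part true (v j))
  → Σ Bool (λ b → u ≗ (λ j → part b (v j)))
choose-part (inj₁ e) = false , e
choose-part (inj₂ e) = true  , e

mix : ∀ {N n} → Subset N → (Fin N → Fin n → ℤ) → (Fin N × Fin n → ℕ)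
mix M z (k , j) = part (lookup M k) (z k j)

mix-column-sums : ∀ {N n} (M : Subset N) (z : Fin N → Fin n → ℤ) j
  → ∑ (λ k → + mix M z (k , j)) + sumOver M z j ≡ ∑ (λ k → + pos (z k j))
mix-column-sums M z j = begin
  ∑ (λ k → + mix M z (k , j)) + sumOver M z j
    ≡⟨ sym (∑-+ (λ k → + mix M z (k , j)) (λ k → if lookup M k then z k j else 0ℤ)) ⟩
  ∑ (λ k → + part (lookup M k) (z k j) + (if lookup M k then z k j else 0ℤ))
    ≡⟨ ∑-cong (λ k → part+selected (lookup M k) (z k j)) ⟩
  ∑ (λ k → + pos (z k j))
    ∎
  where open ≡-Reasoning

InFibre : {C R : Set} → Config C R → (C → ℤ) → (C → ℕ) → Set
InFibre B z x = B (toℤ x) ≗ B (toℤ (z ⁺))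

lawrence-cong : ∀ {d n} N (A : Matrix d n) {x y : Fin N × Fin n → ℤ}
  → x ≗ y → lawrence N A x ≗ lawrence N A y
lawrence-cong N A x≗y (inj₁ (k , i)) = ∑-cong (λ j → cong (λ t → A i j * t) (x≗y (k , j)))
lawrence-cong N A x≗y (inj₂ j)       = ∑-cong (λ k → x≗y (k , j))

InFibre-resp : ∀ {d n N} (A : Matrix d n) (w : Fin N × Fin n → ℤ) {x y : Fin N × Fin n → ℕ}
  → x ≗ y → InFibre (lawrence N A) w x → InFibre (lawrence N A) w y
InFibre-resp {N = N} A w x≗y x∈F r =
  trans (sym (lawrence-cong N A (λ c → cong +_ (x≗y c)) r)) (x∈F r)

Balanced : ∀ {d n} → Matrix d n → (Fin n → ℤ) → Set
Balanced A v = InFibre (act A) v (v ⁻)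

indispensable⇒balanced : ∀ {d n} (A : Matrix d n) (v : Fin n → ℤ)
  → IsIndispensable A v → Balanced A v
indispensable⇒balanced A v (_ , fibre) = Equivalence.from (fibre (v ⁻)) (inj₂ (λ _ → refl))

-- For balanced slices, a mix x_M lies in the A^(N)-fibre of z⁺ iff Σ_{k∈M} z_k = 0:
-- the slice rows always agree and the column-sum rows differ exactly by Σ_{k∈M} z_k.
mix-in-fibre⇔ : ∀ {d n N} (A : Matrix d n) (z : Fin N → Fin n → ℤ)
  → (∀ k → Balanced A (z k)) → (M : Subset N)
  → InFibre (lawrence N A) (flat z) (mix M z) ⇔ IsZeroVec (sumOver M z)
mix-in-fibre⇔ A z balanced M = mk⇔
  (λ x∈F j → Equivalence.to (column j) (x∈F (inj₂ j)))
  (λ sum≡0 → λ { (inj₁ (k , i)) → slice-row (lookup M k) k i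
               ; (inj₂ j)       → Equivalence.from (column j) (sum≡0 j) })
  where
  column : ∀ j → (∑ (λ k → + mix M z (k , j)) ≡ ∑ (λ k → + pos (z k j)))
                 ⇔ (sumOver M z j ≡ 0ℤ)
  column j = offset-zero⇔ (mix-column-sums M z j)

  slice-row : ∀ b k → act A (λ j → + part b (z k j)) ≗ act A (toℤ (z k ⁺))
  slice-row false k _ = refl
  slice-row true  k   = balanced k

-- If every slice is indispensable, each point of the A^(N)-fibre of z⁺ is a mix: its
-- k-th slice lies in the A-fibre of z_k⁺, which is {z_k⁺, z_k⁻}.
fibre⇒mix : ∀ {d n N} (A : Matrix d n) (z : Fin N → Fin n → ℤ)
  → (∀ k → IsIndispensable A (z k))
  → ∀ x → InFibre (lawrence N A) (flat z) x → ∃ λ M → x ≗ mix M z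
fibre⇒mix {N = N} A z indispensable x x∈F = tabulate side , x≗mix
  where
  slice-part : ∀ k → Σ Bool (λ b → (λ j → x (k , j)) ≗ (λ j → part b (z k j)))
  slice-part k = choose-part
    (Equivalence.to (proj₂ (indispensable k) (λ j → x (k , j))) (λ i → x∈F (inj₁ (k , i))))

  side : Fin N → Bool
  side k = proj₁ (slice-part k)

  x≗mix : x ≗ mix (tabulate side) z
  x≗mix (k , j) =
    trans (proj₂ (slice-part k) j) (cong (λ b → part b (z k j)) (sym (lookup∘tabulate side k)))

lawrence-fibre : ∀ {d n N} (A : Matrix d n) (z : Fin N → Fin n → ℤ)
  → (∀ k → IsIndispensable A (z k))
  → ∀ x → InFibre (lawrence N A) (flat z) x
          ⇔ ∃ λ M → x ≗ mix M z × IsZeroVec (sumOver M z)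
lawrence-fibre {N = N} A z indispensable x = mk⇔
  (λ x∈F → let (M , x≗mix) = fibre⇒mix A z indispensable x x∈F in
    M , x≗mix , Equivalence.to (mix-criterion M) (InFibre-resp A (flat z) x≗mix x∈F))
  (λ (M , x≗mix , sum≡0) →
    InFibre-resp A (flat z) (λ c → sym (x≗mix c)) (Equivalence.from (mix-criterion M) sum≡0))
  where
  mix-criterion : (M : Subset N)
    → InFibre (lawrence N A) (flat z) (mix M z) ⇔ IsZeroVec (sumOver M z)
  mix-criterion = mix-in-fibre⇔ A z (λ k → indispensable⇒balanced A (z k) (indispensable k))

∉⇒lookup≡false : ∀ {N} {M : Subset N} {k : Fin N} → k ∉ M → lookup M k ≡ false
∉⇒lookup≡false {M = M} {k} k∉M with lookup M k in eq
... | true  = ⊥-elim (k∉M (lookup⇒[]= k M eq))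
... | false = refl

mix-empty : ∀ {N n} {M : Subset N} (z : Fin N → Fin n → ℤ)
  → (∀ k → k ∉ M) → mix M z ≗ (flat z ⁺)
mix-empty z none (k , j) = cong (λ b → part b (z k j)) (∉⇒lookup≡false (none k))

mix-full : ∀ {N n} {M : Subset N} (z : Fin N → Fin n → ℤ)
  → (∀ k → k ∈ M) → mix M z ≗ (flat z ⁻)
mix-full z all (k , j) = cong (λ b → part b (z k j)) ([]=⇒lookup (all k))

-- Conversely, when all slices are non-zero, only the empty subset gives z⁺ and only a
-- full subset gives z⁻: a slice taking the wrong part would have z_k⁺ = z_k⁻.
mix≗pos⇒empty : ∀ {N n} {M : Subset N} (z : Fin N → Fin n → ℤ)
  → (∀ k → ¬ IsZeroVec (z k)) → mix M z ≗ (flat z ⁺) → ∀ k → k ∉ M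
mix≗pos⇒empty z nonzero mix≗pos k k∈M = nonzero k λ j →
  pos≡neg⇒0 (z k j)
    (sym (subst (λ b → part b (z k j) ≡ pos (z k j)) ([]=⇒lookup k∈M) (mix≗pos (k , j))))

mix≗neg⇒full : ∀ {N n} {M : Subset N} (z : Fin N → Fin n → ℤ)
  → (∀ k → ¬ IsZeroVec (z k)) → mix M z ≗ (flat z ⁻) → ∀ k → k ∈ M
mix≗neg⇒full {M = M} z nonzero mix≗neg k = decidable-stable (k ∈? M) λ k∉M → nonzero k λ j →
  pos≡neg⇒0 (z k j)
    (subst (λ b → part b (z k j) ≡ neg (z k j)) (∉⇒lookup≡false k∉M) (mix≗neg (k , j)))

subset-trichotomy : ∀ {N} (M : Subset N)
  → (∀ k → k ∉ M) ⊎ (∀ k → k ∈ M) ⊎ NonemptyProper M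
subset-trichotomy M with any? (_∈? M) | any? (λ k → ¬? (k ∈? M))
... | no none   | _         = inj₁ (λ k k∈M → none (k , k∈M))
... | yes _     | no noneOut = inj₂ (inj₁ (λ k → decidable-stable (k ∈? M) (λ k∉M → noneOut (k , k∉M))))
... | yes some  | yes out   = inj₂ (inj₂ (some , out))

-- Necessity: if the fibre of z⁺ is contained in {z⁺, z⁻}, no non-empty proper M has
-- Σ_{k∈M} z_k = 0, since otherwise x_M would be a third point of the fibre.
pair-fibre⇒no-vanishing-subsum : ∀ {d n N} (A : Matrix d n) (z : Fin N → Fin n → ℤ)
  → (∀ k → IsIndispensable A (z k)) → (∀ k → ¬ IsZeroVec (z k))
  → (∀ x → InFibre (lawrence N A) (flat z) x → x ≗ (flat z ⁺) ⊎ x ≗ (flat z ⁻))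
  → (M : Subset N) → NonemptyProper M → ¬ IsZeroVec (sumOver M z)
pair-fibre⇒no-vanishing-subsum A z indispensable nonzero fibre⊆pair
  M ((k , k∈M) , (k' , k'∉M)) sum≡0
  with fibre⊆pair (mix M z)
         (Equivalence.from (lawrence-fibre A z indispensable (mix M z)) (M , (λ _ → refl) , sum≡0))
... | inj₁ mix≗pos = mix≗pos⇒empty z nonzero mix≗pos k k∈M
... | inj₂ mix≗neg = k'∉M (mix≗neg⇒full z nonzero mix≗neg k')

-- Sufficiency: without vanishing non-empty proper subsums, the fibre points x_M have
-- M empty or full, i.e. they are z⁺ or z⁻.
no-vanishing-subsum⇒fibre⊆pair : ∀ {d n N} (A : Matrix d n) (z : Fin N → Fin n → ℤ)
  → (∀ k → IsIndispensable A (z k))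
  → ((M : Subset N) → NonemptyProper M → ¬ IsZeroVec (sumOver M z))
  → ∀ x → InFibre (lawrence N A) (flat z) x → x ≗ (flat z ⁺) ⊎ x ≗ (flat z ⁻)
no-vanishing-subsum⇒fibre⊆pair A z indispensable noZeroSum x x∈F
  with Equivalence.to (lawrence-fibre A z indispensable x) x∈F
... | M , x≗mix , sum≡0 with subset-trichotomy M
... | inj₁ empty         = inj₁ (λ c → trans (x≗mix c) (mix-empty z empty c))
... | inj₂ (inj₁ full)   = inj₂ (λ c → trans (x≗mix c) (mix-full z full c))
... | inj₂ (inj₂ proper) = ⊥-elim (noZeroSum M proper sum≡0)

-- For a move z of A^(N) with balanced slices, both z⁺ and z⁻ lie in the fibre of z⁺:
-- z⁻ = x_[N], and Σ_{k∈[N]} z_k = 0 is the column-sum part of B z = 0.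
pair⊆fibre : ∀ {d n N} (A : Matrix d n) (z : Fin N → Fin n → ℤ)
  → IsMoveC (lawrence N A) (flat z) → (∀ k → Balanced A (z k))
  → ∀ x → x ≗ (flat z ⁺) ⊎ x ≗ (flat z ⁻) → InFibre (lawrence N A) (flat z) x
pair⊆fibre A z move balanced x (inj₁ x≗pos) =
  InFibre-resp A (flat z) (λ c → sym (x≗pos c)) (λ _ → refl)
pair⊆fibre A z move balanced x (inj₂ x≗neg) =
  InFibre-resp A (flat z) (λ c → trans (mix-full z (λ _ → ∈⊤) c) (sym (x≗neg c)))
    (Equivalence.from (mix-in-fibre⇔ A z balanced ⊤) total≡0)
  where
  total≡0 : IsZeroVec (sumOver ⊤ z)
  total≡0 j = trans (∑-cong (λ k → cong (λ b → if b then z k j else 0ℤ) ([]=⇒lookup (∈⊤ {x = k}))))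
                    (move (inj₂ j))

proposition2p2 : (d n N : ℕ) → 1 ≤ N → (A : Matrix d n) → (z : Fin N → Fin n → ℤ)
    → IsMoveC (lawrence N A) (flat z)
    → ((k : Fin N) → IsIndispensable A (z k) × ¬ IsZeroVec (z k))
    → IsIndispensableC (lawrence N A) (flat z)
      ⇔ ((M : Subset N) → NonemptyProper M → ¬ IsZeroVec (sumOver M z))
proposition2p2 d n N _ A z move slices = mk⇔
  (λ (_ , fibre≡pair) →
    pair-fibre⇒no-vanishing-subsum A z indispensable nonzero (λ x → Equivalence.to (fibre≡pair x)))
  (λ noZeroSum → move , λ x →
    mk⇔ (no-vanishing-subsum⇒fibre⊆pair A z indispensable noZeroSum x)
        (pair⊆fibre A z move (λ k → indispensable⇒balanced A (z k) (indispensable k)) x))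
  where
  indispensable : ∀ k → IsIndispensable A (z k)
  indispensable k = proj₁ (slices k)

  nonzero : ∀ k → ¬ IsZeroVec (z k)
  nonzero k = proj₂ (slices k)
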